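{- In each of the history calculi $\mathbf{G3}^{Hist}_{\mathsf N}$, $\mathbf{G3}^{Hist}_{\mathsf{NeF}}$, $\mathbf{G3}^{Hist}_{\mathsf{CoPC}}$, $\mathbf{G3}^{Hist}_{\mathsf{MPC}}$, the contraction rule \[\frac{\mathcal H\mid\Gamma,\alpha,\alpha\Rightarrow\varphi}{\mathcal H\mid\Gamma,\alpha\Rightarrow\varphi}\] is admissible: if $\mathcal H\mid\Gamma,\alpha,\alpha\Rightarrow\varphi$ is derivable, then so is $\mathcal H\mid\Gamma,\alpha\Rightarrow\varphi$.
   Context: Formulas are built from a countable set of propositional variables and the constant $\top$ (no $\bot$) using $\land,\lor,\to,\neg$. A history sequent is $\mathcal H\mid\Gamma\Rightarrow\varphi$, where $\mathcal H$ (the history) is a finite set of formulas, $\Gamma$ a finite multiset of formulas, and $\varphi$ a formula (the goal); $(\psi,\mathcal H)$ denotes $\mathcal H$ with $\psi$ added, $\emptyset$ the empty history, and "$\alpha\in\Gamma$" means $\alpha$ occurs in $\Gamma$. Positive rules (each listed as premises / conclusion with side conditions): (ax) $\mathcal H\mid\Gamma,p\Rightarrow p$ ($p$ a propositional variable); ($\top$) $\mathcal H\mid\Gamma\Rightarrow\top$; ($\to$r$_1$) $\emptyset\mid\Gamma,\alpha\Rightarrow\beta$ / $\mathcal H\mid\Gamma\Rightarrow\alpha\to\beta$ if $\alpha\notin\Gamma$; ($\to$r$_2$) $\mathcal H\mid\Gamma\Rightarrow\beta$ / $\mathcal H\mid\Gamma\Rightarrow\alpha\to\beta$ if $\alpha\in\Gamma$;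 ($\to$l) $(\varphi,\mathcal H)\mid\Gamma,\alpha\to\beta\Rightarrow\alpha$ and $\emptyset\mid\Gamma,\alpha\to\beta,\beta\Rightarrow\varphi$ / $\mathcal H\mid\Gamma,\alpha\to\beta\Rightarrow\varphi$ if $\varphi\notin\mathcal H$ and $\beta\notin\Gamma$; ($\land$r) $\mathcal H\mid\Gamma\Rightarrow\alpha$ and $\mathcal H\mid\Gamma\Rightarrow\beta$ / $\mathcal H\mid\Gamma\Rightarrow\alpha\land\beta$; ($\land$l$_1$) $\emptyset\mid\Gamma,\alpha\land\beta,\alpha\Rightarrow\varphi$ / $\mathcal H\mid\Gamma,\alpha\land\beta\Rightarrow\varphi$ if $\alpha\notin\Gamma$; ($\land$l$_2$) the same with $\beta$ in place of the added $\alpha$, if $\beta\notin\Gamma$; ($\lor$r$_i$) $\mathcal H\mid\Gamma\Rightarrow\alpha$ (resp. $\beta$) / $\mathcal H\mid\Gamma\Rightarrow\alpha\lor\beta$; ($\lor$l) $\emptyset\mid\Gamma,\alpha\lor\beta,\alpha\Rightarrow\varphi$ and $\emptyset\mid\Gamma,\alpha\lor\beta,\beta\Rightarrow\varphi$ / $\mathcal H\mid\Gamma,\alpha\lor\beta\Rightarrow\varphi$ if $\alpha,\beta\notin\Gamma$. In the left rules ($\to$l), ($\land$l$_i$), ($\lor$l) the goal $\varphi$ is required to be an atom, a negation or a disjunction. Negation rules: (n$_1$) $\emptyset\mid\Gamma,\neg\alpha,\beta\Rightarrow\alpha$ and $\emptyset\mid\Gamma,\neg\alpha,\alpha\Rightarrow\beta$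 / $\mathcal H\mid\Gamma,\neg\alpha\Rightarrow\neg\beta$ if $\beta\notin\Gamma\cup\{\neg\alpha\}$ and $\alpha\notin\Gamma$; (n$_2$) $\emptyset\mid\Gamma,\neg\alpha,\beta\Rightarrow\alpha$ and $\mathcal H\mid\Gamma,\neg\alpha\Rightarrow\beta$ / $\mathcal H\mid\Gamma,\neg\alpha\Rightarrow\neg\beta$ if $\beta\notin\Gamma\cup\{\neg\alpha\}$ and $\alpha\in\Gamma$; (n$_3$) $(\neg\beta,\mathcal H)\mid\Gamma,\neg\alpha\Rightarrow\alpha$ and $\emptyset\mid\Gamma,\neg\alpha,\alpha\Rightarrow\beta$ / $\mathcal H\mid\Gamma,\neg\alpha\Rightarrow\neg\beta$ if $\neg\beta\notin\mathcal H$, $\beta\in\Gamma\cup\{\neg\alpha\}$, $\alpha\notin\Gamma$; (n$_4$) $(\neg\beta,\mathcal H)\mid\Gamma,\neg\alpha\Rightarrow\alpha$ and $\mathcal H\mid\Gamma,\neg\alpha\Rightarrow\beta$ / $\mathcal H\mid\Gamma,\neg\alpha\Rightarrow\neg\beta$ if $\neg\beta\notin\mathcal H$, $\beta\in\Gamma\cup\{\neg\alpha\}$, $\alpha\in\Gamma$; (nef) $(\neg\beta,\mathcal H)\mid\Gamma,\neg\alpha\Rightarrow\alpha$ / $\mathcal H\mid\Gamma,\neg\alpha\Rightarrow\neg\beta$ if $\neg\beta\notin\mathcal H$; (copc$_1$) $\emptyset\mid\Gamma,\neg\alpha,\beta\Rightarrow\alpha$ / $\mathcal H\mid\Gamma,\neg\alpha\Rightarrow\neg\beta$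 if $\beta\notin\Gamma\cup\{\neg\alpha\}$; (copc$_2$) $(\neg\beta,\mathcal H)\mid\Gamma,\neg\alpha\Rightarrow\alpha$ / $\mathcal H\mid\Gamma,\neg\alpha\Rightarrow\neg\beta$ if $\neg\beta\notin\mathcal H$ and $\beta\in\Gamma\cup\{\neg\alpha\}$; (an) $\emptyset\mid\Gamma,\alpha\Rightarrow\neg\alpha$ / $\mathcal H\mid\Gamma\Rightarrow\neg\alpha$ if $\alpha\notin\Gamma$. The calculi consist of the positive rules plus: $\mathbf{G3}^{Hist}_{\mathsf N}$: (n$_1$)–(n$_4$); $\mathbf{G3}^{Hist}_{\mathsf{NeF}}$: (n$_1$)–(n$_4$) and (nef); $\mathbf{G3}^{Hist}_{\mathsf{CoPC}}$: (copc$_1$), (copc$_2$); $\mathbf{G3}^{Hist}_{\mathsf{MPC}}$: (copc$_1$), (copc$_2$), (an). -}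

module Defs where

open import Data.Nat using (ℕ)
open import Data.List using (List; []; _∷_)
open import Data.List.Membership.Propositional using (_∈_; _∉_)

infixr 6 _∧ᶠ_
infixr 5 _∨ᶠ_
infixr 4 _⊃_
infix 7 ¬ᶠ_

data Formula : Set where
  var   : ℕ → Formula
  top   : Formula
  _∧ᶠ_  : Formula → Formula → Formula
  _∨ᶠ_  : Formula → Formula → Formula
  _⊃_   : Formula → Formula → Formula
  ¬ᶠ_   : Formula → Formula

-- Histories are finite sets of formulas, represented by lists (only membership
-- is ever consulted).  Contexts Γ are finite multisets, represented by lists;
-- every rule below picks its principal formula by membership and all side
-- conditions are membership conditions, so derivability is invariant under
-- permutation of the context, i.e. the list really represents a multiset.
History : Set
History = List Formula

Context : Set
Context = List Formula

data LeftGoal : Formula → Set where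
  atomG : ∀ n → LeftGoal (var n)
  negG  : ∀ α → LeftGoal (¬ᶠ α)
  disjG : ∀ α β → LeftGoal (α ∨ᶠ β)

data Calculus : Set where
  N NeF CoPC MPC : Calculus

data HasN : Calculus → Set where
  inN   : HasN N
  inNeF : HasN NeF

data HasNef : Calculus → Set where
  inNeF : HasNef NeF

data HasCopc : Calculus → Set where
  inCoPC : HasCopc CoPC
  inMPC  : HasCopc MPC

data HasAn : Calculus → Set where
  inMPC : HasAn MPC

-- In a rule whose conclusion is  H ∣ Γ , χ ⇒ φ  (χ principal), Δ is the whole
-- antecedent Γ , χ; the premise antecedent Γ , χ , ψ is ψ ∷ Δ.  The side
-- conditions "ψ ∉ Γ" are stated as "ψ ∉ Δ", which is equivalent because in
-- each case ψ differs syntactically from the principal formula χ (and for the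
-- negation rules "β ∉ Γ ∪ {¬α}" is exactly "β ∉ Δ").
data _⊢_∣_⇒_ (c : Calculus) : History → Context → Formula → Set where
  ax   : ∀ {H Δ n} → var n ∈ Δ → c ⊢ H ∣ Δ ⇒ var n
  topR : ∀ {H Δ} → c ⊢ H ∣ Δ ⇒ top
  impR₁ : ∀ {H Δ α β} → α ∉ Δ →
          c ⊢ [] ∣ α ∷ Δ ⇒ β →
          c ⊢ H ∣ Δ ⇒ (α ⊃ β)
  impR₂ : ∀ {H Δ α β} → α ∈ Δ →
          c ⊢ H ∣ Δ ⇒ β →
          c ⊢ H ∣ Δ ⇒ (α ⊃ β)
  impL : ∀ {H Δ α β φ} → (α ⊃ β) ∈ Δ → LeftGoal φ → φ ∉ H → β ∉ Δ →
         c ⊢ (φ ∷ H) ∣ Δ ⇒ α →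
         c ⊢ [] ∣ β ∷ Δ ⇒ φ →
         c ⊢ H ∣ Δ ⇒ φ
  andR : ∀ {H Δ α β} →
         c ⊢ H ∣ Δ ⇒ α → c ⊢ H ∣ Δ ⇒ β →
         c ⊢ H ∣ Δ ⇒ (α ∧ᶠ β)
  andL₁ : ∀ {H Δ α β φ} → (α ∧ᶠ β) ∈ Δ → LeftGoal φ → α ∉ Δ →
          c ⊢ [] ∣ α ∷ Δ ⇒ φ →
          c ⊢ H ∣ Δ ⇒ φ
  andL₂ : ∀ {H Δ α β φ} → (α ∧ᶠ β) ∈ Δ → LeftGoal φ → β ∉ Δ →
          c ⊢ [] ∣ β ∷ Δ ⇒ φ →
          c ⊢ H ∣ Δ ⇒ φ
  orR₁ : ∀ {H Δ α β} → c ⊢ H ∣ Δ ⇒ α → c ⊢ H ∣ Δ ⇒ (α ∨ᶠ β)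
  orR₂ : ∀ {H Δ α β} → c ⊢ H ∣ Δ ⇒ β → c ⊢ H ∣ Δ ⇒ (α ∨ᶠ β)
  orL  : ∀ {H Δ α β φ} → (α ∨ᶠ β) ∈ Δ → LeftGoal φ → α ∉ Δ → β ∉ Δ →
         c ⊢ [] ∣ α ∷ Δ ⇒ φ →
         c ⊢ [] ∣ β ∷ Δ ⇒ φ →
         c ⊢ H ∣ Δ ⇒ φ
  n₁ : ∀ {H Δ α β} → HasN c → (¬ᶠ α) ∈ Δ → β ∉ Δ → α ∉ Δ →
       c ⊢ [] ∣ β ∷ Δ ⇒ α →
       c ⊢ [] ∣ α ∷ Δ ⇒ β →
       c ⊢ H ∣ Δ ⇒ (¬ᶠ β)
  n₂ : ∀ {H Δ α β} → HasN c → (¬ᶠ α) ∈ Δ → β ∉ Δ → α ∈ Δ →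
       c ⊢ [] ∣ β ∷ Δ ⇒ α →
       c ⊢ H ∣ Δ ⇒ β →
       c ⊢ H ∣ Δ ⇒ (¬ᶠ β)
  n₃ : ∀ {H Δ α β} → HasN c → (¬ᶠ α) ∈ Δ → (¬ᶠ β) ∉ H → β ∈ Δ → α ∉ Δ →
       c ⊢ (¬ᶠ β ∷ H) ∣ Δ ⇒ α →
       c ⊢ [] ∣ α ∷ Δ ⇒ β →
       c ⊢ H ∣ Δ ⇒ (¬ᶠ β)
  n₄ : ∀ {H Δ α β} → HasN c → (¬ᶠ α) ∈ Δ → (¬ᶠ β) ∉ H → β ∈ Δ → α ∈ Δ →
       c ⊢ (¬ᶠ β ∷ H) ∣ Δ ⇒ α →
       c ⊢ H ∣ Δ ⇒ β →
       c ⊢ H ∣ Δ ⇒ (¬ᶠ β)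
  nef : ∀ {H Δ α β} → HasNef c → (¬ᶠ α) ∈ Δ → (¬ᶠ β) ∉ H →
        c ⊢ (¬ᶠ β ∷ H) ∣ Δ ⇒ α →
        c ⊢ H ∣ Δ ⇒ (¬ᶠ β)
  copc₁ : ∀ {H Δ α β} → HasCopc c → (¬ᶠ α) ∈ Δ → β ∉ Δ →
          c ⊢ [] ∣ β ∷ Δ ⇒ α →
          c ⊢ H ∣ Δ ⇒ (¬ᶠ β)
  copc₂ : ∀ {H Δ α β} → HasCopc c → (¬ᶠ α) ∈ Δ → (¬ᶠ β) ∉ H → β ∈ Δ →
          c ⊢ (¬ᶠ β ∷ H) ∣ Δ ⇒ α →
          c ⊢ H ∣ Δ ⇒ (¬ᶠ β)
  an : ∀ {H Δ α} → HasAn c → α ∉ Δ →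
       c ⊢ [] ∣ α ∷ Δ ⇒ (¬ᶠ α) →
       c ⊢ H ∣ Δ ⇒ (¬ᶠ α)

module Submission where

-- Contraction is admissible because the calculi never count occurrences.
-- Every rule selects its principal formula by membership in the antecedent,
-- and every side condition on the antecedent is a membership or
-- non-membership condition.  Hence derivability of  H ∣ Δ ⇒ φ  depends on Δ
-- only through the set of formulas occurring in it.
--
-- Since  α, α, Γ
-- and  α, Γ  have the same elements, lemma5p3 follows at once, uniformly in
-- the calculus; the transformation keeps the shape of the derivation, so
-- contraction is even height preserving.

open import Defs
open import Data.List using (_∷_)
open import Data.List.Membership.Propositional using (_∈_; _∉_)
open import Data.List.Relation.Unary.Any using (here)
open import Data.List.Relation.Binary.Subset.Propositional using (_⊆_)
open import Data.List.Relation.Binary.Subset.Propositional.Properties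
  using (⊆-refl; xs⊆x∷xs; ∷⁺ʳ; ∈-∷⁺ʳ)
open import Relation.Binary.PropositionalEquality using (refl)

record SameElements (Δ Δ′ : Context) : Set where
  field
    sub : Δ ⊆ Δ′
    sup : Δ′ ⊆ Δ
open SameElements

∷-sameElements : ∀ {Δ Δ′} ψ → SameElements Δ Δ′ →
                 SameElements (ψ ∷ Δ) (ψ ∷ Δ′)
∷-sameElements ψ e = record { sub = ∷⁺ʳ ψ (sub e) ; sup = ∷⁺ʳ ψ (sup e) }

∉-sameElements : ∀ {Δ Δ′ ψ} → SameElements Δ Δ′ → ψ ∉ Δ → ψ ∉ Δ′
∉-sameElements e ψ∉Δ ψ∈Δ′ = ψ∉Δ (sup e ψ∈Δ′)

⊢-sameElements : ∀ {c H Δ Δ′ φ} → SameElements Δ Δ′ →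
                 c ⊢ H ∣ Δ ⇒ φ → c ⊢ H ∣ Δ′ ⇒ φ
⊢-sameElements e (ax p∈) = ax (sub e p∈)
⊢-sameElements e topR = topR
⊢-sameElements e (impR₁ α∉ d) =
  impR₁ (∉-sameElements e α∉) (⊢-sameElements (∷-sameElements _ e) d)
⊢-sameElements e (impR₂ α∈ d) = impR₂ (sub e α∈) (⊢-sameElements e d)
⊢-sameElements e (impL imp∈ g φ∉H β∉ d₁ d₂) =
  impL (sub e imp∈) g φ∉H (∉-sameElements e β∉)
       (⊢-sameElements e d₁) (⊢-sameElements (∷-sameElements _ e) d₂)
⊢-sameElements e (andR d₁ d₂) = andR (⊢-sameElements e d₁) (⊢-sameElements e d₂)
⊢-sameElements e (andL₁ conj∈ g α∉ d) =
  andL₁ (sub e conj∈) g (∉-sameElements e α∉) (⊢-sameElements (∷-sameElements _ e) d)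
⊢-sameElements e (andL₂ conj∈ g β∉ d) =
  andL₂ (sub e conj∈) g (∉-sameElements e β∉) (⊢-sameElements (∷-sameElements _ e) d)
⊢-sameElements e (orR₁ d) = orR₁ (⊢-sameElements e d)
⊢-sameElements e (orR₂ d) = orR₂ (⊢-sameElements e d)
⊢-sameElements e (orL disj∈ g α∉ β∉ d₁ d₂) =
  orL (sub e disj∈) g (∉-sameElements e α∉) (∉-sameElements e β∉)
      (⊢-sameElements (∷-sameElements _ e) d₁) (⊢-sameElements (∷-sameElements _ e) d₂)
⊢-sameElements e (n₁ k neg∈ β∉ α∉ d₁ d₂) =
  n₁ k (sub e neg∈) (∉-sameElements e β∉) (∉-sameElements e α∉)
     (⊢-sameElements (∷-sameElements _ e) d₁) (⊢-sameElements (∷-sameElements _ e) d₂)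
⊢-sameElements e (n₂ k neg∈ β∉ α∈ d₁ d₂) =
  n₂ k (sub e neg∈) (∉-sameElements e β∉) (sub e α∈)
     (⊢-sameElements (∷-sameElements _ e) d₁) (⊢-sameElements e d₂)
⊢-sameElements e (n₃ k neg∈ ¬β∉H β∈ α∉ d₁ d₂) =
  n₃ k (sub e neg∈) ¬β∉H (sub e β∈) (∉-sameElements e α∉)
     (⊢-sameElements e d₁) (⊢-sameElements (∷-sameElements _ e) d₂)
⊢-sameElements e (n₄ k neg∈ ¬β∉H β∈ α∈ d₁ d₂) =
  n₄ k (sub e neg∈) ¬β∉H (sub e β∈) (sub e α∈)
     (⊢-sameElements e d₁) (⊢-sameElements e d₂)
⊢-sameElements e (nef k neg∈ ¬β∉H d) = nef k (sub e neg∈) ¬β∉H (⊢-sameElements e d)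
⊢-sameElements e (copc₁ k neg∈ β∉ d) =
  copc₁ k (sub e neg∈) (∉-sameElements e β∉) (⊢-sameElements (∷-sameElements _ e) d)
⊢-sameElements e (copc₂ k neg∈ ¬β∉H β∈ d) =
  copc₂ k (sub e neg∈) ¬β∉H (sub e β∈) (⊢-sameElements e d)
⊢-sameElements e (an k α∉ d) =
  an k (∉-sameElements e α∉) (⊢-sameElements (∷-sameElements _ e) d)

duplicate-sameElements : ∀ α Γ → SameElements (α ∷ α ∷ Γ) (α ∷ Γ)
duplicate-sameElements α Γ = record
  { sub = ∈-∷⁺ʳ (here refl) ⊆-refl
  ; sup = xs⊆x∷xs (α ∷ Γ) α
  }

lemma5p3 : (c : Calculus) (H : History) (Γ : Context) (α φ : Formula) →
           c ⊢ H ∣ α ∷ α ∷ Γ ⇒ φ → c ⊢ H ∣ α ∷ Γ ⇒ φ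
lemma5p3 c H Γ α φ = ⊢-sameElements (duplicate-sameElements α Γ)
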